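{- Let $\mathcal{C}$ be a simple trim binary Boolean VCSP instance with weights $c_i,c_{ij}$, and let $\mathcal{C}'$ be a simple binary Boolean VCSP instance with weights $c'_i,c'_{ij}$ that is sign-equivalent to $\mathcal{C}$. Then (1) $\mathrm{sgn}(c_i)=\mathrm{sgn}(c'_i)$ for all $i\in[n]$; and (2) $\mathrm{sgn}(c_{ij})=\mathrm{sgn}(c'_{ij})$ for all $\{i,j\}\in E(\mathcal{C})$.
   Context: Variables are indexed by $[n]$, each with domain $\{0,1\}$; $x[i\mapsto b]$ is $x$ with coordinate $i$ set to $b$, $\bar b=1-b$. A (valued) constraint with scope $S\subseteq[n]$ is a function $C_S:\{0,1\}^S\to\mathbb{Z}$. A binary Boolean VCSP instance is a finite set of constraints with scopes of size at most $2$, at most one per scope; it implements $f(x)=\sum_{C_S\in\mathcal{C}}C_S(x[S])$. Its fitness graph $G_\mathcal{C}$ has vertex set $\{0,1\}^n$ and a directed edge $(x,y)$ iff $x,y$ differ in exactly one coordinate and $f(y)>f(x)$; two instances are sign-equivalent if they have the same fitness graph. The constraint graph has edge set $E(\mathcal{C})$ of those $\{i,j\}$ with a binary constraint of scope $\{i,j\}$ not identically zero. An instance is simple if every unary constraint satisfies $C_i(0)=0,C_i(1)=c_i$ and every binary constraint satisfies $C_{ij}(0,0)=C_{ij}(0,1)=C_{ij}(1,0)=0$, $C_{ij}(1,1)=c_{ij}$ (a constant constraint is allowed); absent constraints have weight $0$. In $G_\mathcal{C}$, $i$ sign-depends on $j$ if there is $x$ with $(x,x[i\mapsto\bar x_i])\in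 E(G_\mathcal{C})$ but $(x[j\mapsto \bar x_j],x[i\mapsto\bar x_i,j\mapsto\bar x_j])\notin E(G_\mathcal{C})$; $i,j$ sign-interact if either sign-depends on the other. A simple instance is trim if for every $\{i,j\}\in E(\mathcal{C})$, $i$ and $j$ sign-interact in $G_\mathcal{C}$. -}

module Defs where

open import Data.Nat using (ℕ; zero; suc)
open import Data.Fin using (Fin; zero; suc; _<_; _<?_)
open import Data.Fin.Properties using (_≟_)
open import Data.Bool using (Bool; true; false; not)
open import Data.Integer using (ℤ; +_; -[1+_]; _+_; _*_; 0ℤ; 1ℤ; -1ℤ)
  renaming (_<_ to _<ℤ_)
open import Data.Product using (Σ; ∃; _×_; _,_)
open import Data.Sum using (_⊎_)
open import Relation.Nullary using (¬_; yes; no)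
open import Relation.Binary.PropositionalEquality using (_≡_)

Assignment : ℕ → Set
Assignment n = Fin n → Bool

update : ∀ {n} → Assignment n → Fin n → Bool → Assignment n
update x i b k with k ≟ i
... | yes _ = b
... | no  _ = x k

flip : ∀ {n} → Assignment n → Fin n → Assignment n
flip x i = update x i (not (x i))

bit : Bool → ℤ
bit false = 0ℤ
bit true  = 1ℤ

sumFin : ∀ n → (Fin n → ℤ) → ℤ
sumFin zero    g = 0ℤ
sumFin (suc n) g = g zero + sumFin n (λ k → g (suc k))

-- A simple binary Boolean VCSP instance on variables [n].
-- unary i  = c_i  (constraint C_i with C_i(0)=0, C_i(1)=c_i; absent = 0).
-- binary i j for i < j is c_ij, the weight of the (unique) constraint with
-- scope {i,j}; entries with i ≥ j are ignored.
-- const is an optional constant (nullary) constraint.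
record SimpleInstance (n : ℕ) : Set where
  field
    const  : ℤ
    unary  : Fin n → ℤ
    binary : Fin n → Fin n → ℤ
open SimpleInstance public

pairTerm : ∀ {n} → SimpleInstance n → Assignment n → Fin n → Fin n → ℤ
pairTerm C x i j with i <? j
... | yes _ = binary C i j * (bit (x i) * bit (x j))
... | no  _ = 0ℤ

eval : ∀ {n} → SimpleInstance n → Assignment n → ℤ
eval {n} C x =
  const C
  + sumFin n (λ i → unary C i * bit (x i))
  + sumFin n (λ i → sumFin n (λ j → pairTerm C x i j))

Edge : ∀ {n} → SimpleInstance n → Assignment n → Assignment n → Set
Edge C x y = (∃ λ i → y ≡ flip x i) × (eval C x <ℤ eval C y)

SignEquivalent : ∀ {n} → SimpleInstance n → SimpleInstance n → Set
SignEquivalent C C' =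
  ∀ x y → (Edge C x y → Edge C' x y) × (Edge C' x y → Edge C x y)

SignDepends : ∀ {n} → SimpleInstance n → Fin n → Fin n → Set
SignDepends C i j =
  ∃ λ x → Edge C x (flip x i) × ¬ Edge C (flip x j) (flip (flip x j) i)

SignInteract : ∀ {n} → SimpleInstance n → Fin n → Fin n → Set
SignInteract C i j = SignDepends C i j ⊎ SignDepends C j i

InE : ∀ {n} → SimpleInstance n → Fin n → Fin n → Set
InE C i j = (i < j) × ¬ (binary C i j ≡ 0ℤ)

Trim : ∀ {n} → SimpleInstance n → Set
Trim C = ∀ i j → InE C i j → SignInteract C i j

sgn : ℤ → ℤ
sgn (+ zero)    = 0ℤ
sgn (+ suc _)   = 1ℤ
sgn -[1+ _ ]    = -1ℤ

-- The unary weight c_i is read off the edges between 0 and the unit vector e_i,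
-- since f(e_i) - f(0) = c_i.  For a binary weight, the mixed second difference
-- f(x^{ij}) - f(x^j) - f(x^i) + f(x) of a simple instance equals
-- c_ij (1 - 2x_i)(1 - 2x_j): every other constraint ignores x_i or x_j.  If i
-- sign-depends on j at x, this difference is negative, and since that is visible
-- in the fitness graph alone, the same holds for C'; so c_ij s and c'_ij s are
-- both negative for s = (1 - 2x_i)(1 - 2x_j) = ±1.
module Submission where

open import Defs
open import Data.Nat using (ℕ; zero; suc)
open import Data.Bool using (Bool; false; not)
open import Data.Bool.Properties using (not-involutive)
open import Data.Fin using (Fin; zero; suc; _<?_) renaming (_<_ to _<ᶠ_)
open import Data.Fin.Properties using (_≟_; suc-injective; <⇒≢; <-asym)
open import Data.Integer using (ℤ; +_; -[1+_]; _+_; _*_; _-_; -_; 0ℤ; 1ℤ; -1ℤ; _<_; _≤_; +[1+_]; +<+)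
import Data.Integer.Properties as ℤ
open import Data.Integer.Tactic.RingSolver using (solve-∀)
open import Data.Product using (_×_; _,_; proj₁; proj₂; map)
open import Data.Sum using (inj₁; inj₂)
open import Data.Empty using (⊥-elim)
open import Function.Base using (_∘_)
open import Function.Bundles using (_⇔_; mk⇔; Equivalence)
import Function.Properties.Equivalence as ⇔
open import Relation.Nullary using (¬_; yes; no; Dec)
open import Relation.Binary.Definitions using (tri<; tri≈; tri>)
open import Relation.Binary.PropositionalEquality
open ≡-Reasoning

private
  variable
    n : ℕ
    x y z : Assignment n
    i j k : Fin n

+-monoʳ-<-⇔ : ∀ c {a b} → a < b ⇔ c + a < c + b
+-monoʳ-<-⇔ c {a} {b} = mk⇔ (ℤ.+-monoʳ-< c) cancel
  where
  cancel : c + a < c + b → a < b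
  cancel lt = subst₂ _<_ (cancelˡ c a) (cancelˡ c b) (ℤ.+-monoʳ-< (- c) lt)
    where
    cancelˡ : ∀ c t → - c + (c + t) ≡ t
    cancelˡ = solve-∀

i-j-k+l<0 : ∀ {a b c d} → a ≤ b → d < c → a - b - c + d < 0ℤ
i-j-k+l<0 {a} {b} {c} {d} a≤b d<c =
  subst₂ _<_ (rearrange a b c d) (ℤ.+-inverseʳ (b + c)) (ℤ.+-monoˡ-< (- (b + c)) (ℤ.+-mono-≤-< a≤b d<c))
  where
  rearrange : ∀ a b c d → (a + d) - (b + c) ≡ a - b - c + d
  rearrange = solve-∀

sgn-pos : ∀ {c} → 0ℤ < c → sgn c ≡ 1ℤ
sgn-pos {+[1+ _ ]} _ = refl
sgn-pos {+ zero}   0<0 = ⊥-elim (ℤ.<-irrefl refl 0<0)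
sgn-pos { -[1+ _ ]} ()

sgn-neg : ∀ {c} → c < 0ℤ → sgn c ≡ -1ℤ
sgn-neg { -[1+ _ ]} _ = refl
sgn-neg {+ zero}   0<0 = ⊥-elim (ℤ.<-irrefl refl 0<0)
sgn-neg {+[1+ _ ]} (+<+ ())

sgn-cong : ∀ {c c′} → (0ℤ < c ⇔ 0ℤ < c′) → (c < 0ℤ ⇔ c′ < 0ℤ) → sgn c ≡ sgn c′
sgn-cong {c} {c′} pos neg with ℤ.<-cmp c 0ℤ | ℤ.<-cmp c′ 0ℤ
... | tri< c<0 _ _ | _ = trans (sgn-neg c<0) (sym (sgn-neg (Equivalence.to neg c<0)))
... | tri> _ _ 0<c | _ = trans (sgn-pos 0<c) (sym (sgn-pos (Equivalence.to pos 0<c)))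
... | tri≈ _ refl _ | tri≈ _ refl _ = refl
... | tri≈ _ refl _ | tri< c′<0 _ _ = ⊥-elim (ℤ.<-irrefl refl (Equivalence.from neg c′<0))
... | tri≈ _ refl _ | tri> _ _ 0<c′ = ⊥-elim (ℤ.<-irrefl refl (Equivalence.from pos 0<c′))

sgn-cong-*-neg : ∀ {c c′} s → c * s < 0ℤ → c′ * s < 0ℤ → sgn c ≡ sgn c′
sgn-cong-*-neg {c} (+ zero) c0<0 _ = ⊥-elim (ℤ.<-irrefl (ℤ.*-zeroʳ c) c0<0)
sgn-cong-*-neg s@(+[1+ _ ]) cs<0 c′s<0 =
  trans (sgn-neg (ℤ.*-cancelʳ-<-nonNeg s cs<0)) (sym (sgn-neg (ℤ.*-cancelʳ-<-nonNeg s c′s<0)))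
sgn-cong-*-neg -[1+ k ] cs<0 c′s<0 =
  trans (sgn-pos (ℤ.*-cancelʳ-<-neg k cs<0)) (sym (sgn-pos (ℤ.*-cancelʳ-<-neg k c′s<0)))

flip-self : (x : Assignment n) (i : Fin n) → flip x i i ≡ not (x i)
flip-self x i with i ≟ i
... | yes _  = refl
... | no i≢i = ⊥-elim (i≢i refl)

flip-other : (x : Assignment n) → k ≢ i → flip x i k ≡ x k
flip-other {k = k} {i} x k≢i with k ≟ i
... | yes k≡i = ⊥-elim (k≢i k≡i)
... | no _    = refl

flip-involutive : (x : Assignment n) (i k : Fin n) → flip (flip x i) i k ≡ x k
flip-involutive x i k = go (k ≟ i)
  where
  go : Dec (k ≡ i) → flip (flip x i) i k ≡ x k
  go (yes refl) = trans (flip-self (flip x k) k)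
                    (trans (cong not (flip-self x k)) (not-involutive (x k)))
  go (no k≢i)   = trans (flip-other (flip x i) k≢i) (flip-other x k≢i)

flip-comm : (x : Assignment n) → i ≢ j → ∀ k → flip (flip x i) j k ≡ flip (flip x j) i k
flip-comm {i = i} {j} x i≢j k = go (k ≟ i) (k ≟ j)
  where
  go : Dec (k ≡ i) → Dec (k ≡ j) → flip (flip x i) j k ≡ flip (flip x j) i k
  go (yes refl) (yes refl) = ⊥-elim (i≢j refl)
  go (yes refl) (no k≢j)   = trans (flip-other (flip x k) k≢j)
    (trans (flip-self x k) (sym (trans (flip-self (flip x j) k) (cong not (flip-other x k≢j)))))
  go (no k≢i)   (yes refl) = trans (flip-self (flip x i) k)
    (trans (cong not (flip-other x k≢i)) (sym (trans (flip-other (flip x k) k≢i) (flip-self x k))))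
  go (no k≢i)   (no k≢j)   = trans (flip-other (flip x i) k≢j)
    (trans (flip-other x k≢i) (sym (trans (flip-other (flip x j) k≢i) (flip-other x k≢j))))

AgreeOff : Fin n → Assignment n → Assignment n → Set
AgreeOff k y z = ∀ m → m ≢ k → y m ≡ z m

IndependentOf : (Assignment n → ℤ) → Fin n → Set
IndependentOf h k = ∀ {y z} → AgreeOff k y z → h y ≡ h z

flip-agreeOff : (x : Assignment n) (i : Fin n) → AgreeOff i (flip x i) x
flip-agreeOff x i m = flip-other x

flip-flip-agreeOff : (x : Assignment n) → i ≢ j →
                     AgreeOff j (flip (flip x j) i) (flip x i)
flip-flip-agreeOff {i = i} {j} x i≢j m m≢j = go (m ≟ i)
  where
  go : Dec (m ≡ i) → flip (flip x j) i m ≡ flip x i m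
  go (yes refl) = trans (flip-self (flip x j) m)
                    (trans (cong not (flip-other x m≢j)) (sym (flip-self x m)))
  go (no m≢i)   = trans (flip-other (flip x j) m≢i)
                    (trans (flip-other x m≢j) (sym (flip-other x m≢i)))

sumFin-cong : ∀ m {f g : Fin m → ℤ} → (∀ k → f k ≡ g k) → sumFin m f ≡ sumFin m g
sumFin-cong zero    f≗g = refl
sumFin-cong (suc m) f≗g = cong₂ _+_ (f≗g zero) (sumFin-cong m (λ k → f≗g (suc k)))

sumFin-zero : ∀ m {f : Fin m → ℤ} → (∀ k → f k ≡ 0ℤ) → sumFin m f ≡ 0ℤ
sumFin-zero m f≗0 = trans (sumFin-cong m f≗0) (sum-of-zeros m)
  where
  sum-of-zeros : ∀ m → sumFin m (λ _ → 0ℤ) ≡ 0ℤ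
  sum-of-zeros zero    = refl
  sum-of-zeros (suc m) = trans (ℤ.+-identityˡ _) (sum-of-zeros m)

sumFin-single : ∀ m {f : Fin m → ℤ} (i : Fin m) → (∀ k → k ≢ i → f k ≡ 0ℤ) →
                sumFin m f ≡ f i
sumFin-single (suc m) {f} zero    f≗0 = begin
  f zero + sumFin m (λ k → f (suc k)) ≡⟨ cong (λ t → f zero + t) (sumFin-zero m (λ k → f≗0 (suc k) λ ())) ⟩
  f zero + 0ℤ                         ≡⟨ ℤ.+-identityʳ (f zero) ⟩
  f zero                              ∎
sumFin-single (suc m) {f} (suc i) f≗0 = begin
  f zero + sumFin m (λ k → f (suc k)) ≡⟨ cong (_+ sumFin m (λ k → f (suc k))) (f≗0 zero λ ()) ⟩
  0ℤ + sumFin m (λ k → f (suc k))     ≡⟨ ℤ.+-identityˡ _ ⟩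
  sumFin m (λ k → f (suc k))          ≡⟨ sumFin-single m i (λ k k≢i → f≗0 (suc k) (k≢i ∘ suc-injective)) ⟩
  f (suc i)                           ∎

mixedDiff : (Assignment n → ℤ) → Assignment n → Fin n → Fin n → ℤ
mixedDiff h x i j = h (flip (flip x j) i) - h (flip x j) - h (flip x i) + h x

mixedDiff-+ : (g h : Assignment n → ℤ) (x : Assignment n) (i j : Fin n) →
              mixedDiff (λ y → g y + h y) x i j ≡ mixedDiff g x i j + mixedDiff h x i j
mixedDiff-+ g h x i j =
  rearrange (g (flip (flip x j) i)) (g (flip x j)) (g (flip x i)) (g x)
            (h (flip (flip x j) i)) (h (flip x j)) (h (flip x i)) (h x)
  where
  rearrange : ∀ a b c d a′ b′ c′ d′ →
    (a + a′) - (b + b′) - (c + c′) + (d + d′) ≡ (a - b - c + d) + (a′ - b′ - c′ + d′)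
  rearrange = solve-∀

mixedDiff-sumFin : ∀ m (g : Fin m → Assignment n → ℤ) (x : Assignment n) (i j : Fin n) →
  mixedDiff (λ y → sumFin m (λ k → g k y)) x i j ≡ sumFin m (λ k → mixedDiff (g k) x i j)
mixedDiff-sumFin zero    g x i j = refl
mixedDiff-sumFin (suc m) g x i j =
  trans (mixedDiff-+ (g zero) (λ y → sumFin m (λ k → g (suc k) y)) x i j)
        (cong (λ t → mixedDiff (g zero) x i j + t) (mixedDiff-sumFin m (λ k → g (suc k)) x i j))

mixedDiff-independentˡ : (h : Assignment n → ℤ) → IndependentOf h i →
                         ∀ x j → mixedDiff h x i j ≡ 0ℤ
mixedDiff-independentˡ {i = i} h h⊥i x j
  rewrite h⊥i (flip-agreeOff (flip x j) i) | h⊥i (flip-agreeOff x i) = cancel (h (flip x j)) (h x)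
  where
  cancel : ∀ a b → a - a - b + b ≡ 0ℤ
  cancel = solve-∀

mixedDiff-independentʳ : (h : Assignment n → ℤ) → IndependentOf h j → i ≢ j →
                         ∀ x → mixedDiff h x i j ≡ 0ℤ
mixedDiff-independentʳ {j = j} {i = i} h h⊥j i≢j x
  rewrite h⊥j (flip-flip-agreeOff x i≢j) | h⊥j (flip-agreeOff x j) = cancel (h (flip x i)) (h x)
  where
  cancel : ∀ a b → a - b - a + b ≡ 0ℤ
  cancel = solve-∀

mixedDiff-sym : (h : Assignment n → ℤ) → (∀ {y z} → (∀ k → y k ≡ z k) → h y ≡ h z) →
                i ≢ j → ∀ x → mixedDiff h x j i ≡ mixedDiff h x i j
mixedDiff-sym {i = i} {j} h h-ext i≢j x
  rewrite h-ext (flip-comm x i≢j) = swap (h (flip (flip x j) i)) (h (flip x i)) (h (flip x j)) (h x)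
  where
  swap : ∀ a b c d → a - b - c + d ≡ a - c - b + d
  swap = solve-∀

module _ (C : SimpleInstance n) where

  pairTerm-≮ : (y : Assignment n) {a b : Fin n} → ¬ a <ᶠ b → pairTerm C y a b ≡ 0ℤ
  pairTerm-≮ y {a} {b} a≮b with a <? b
  ... | yes a<b = ⊥-elim (a≮b a<b)
  ... | no _    = refl

  pairTerm-< : (y : Assignment n) {a b : Fin n} → a <ᶠ b →
               pairTerm C y a b ≡ binary C a b * (bit (y a) * bit (y b))
  pairTerm-< y {a} {b} a<b with a <? b
  ... | yes _   = refl
  ... | no a≮b  = ⊥-elim (a≮b a<b)

  pairTerm-cong : ∀ a b → y a ≡ z a → y b ≡ z b → pairTerm C y a b ≡ pairTerm C z a b
  pairTerm-cong a b ya≡za yb≡zb with a <? b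
  ... | yes _ = cong₂ (λ u v → binary C a b * (bit u * bit v)) ya≡za yb≡zb
  ... | no _  = refl

  pairTerm-independent : ∀ {a b} → a ≢ k → b ≢ k → IndependentOf (λ y → pairTerm C y a b) k
  pairTerm-independent {a = a} {b} a≢k b≢k y≈z = pairTerm-cong a b (y≈z a a≢k) (y≈z b b≢k)

  unaryTerm-independent : k ≢ i → IndependentOf (λ y → unary C k * bit (y k)) i
  unaryTerm-independent {k = k} k≢i y≈z = cong (λ b → unary C k * bit b) (y≈z k k≢i)

  eval-cong : (∀ k → y k ≡ z k) → eval C y ≡ eval C z
  eval-cong y≗z =
    cong₂ _+_ (cong (λ t → const C + t) (sumFin-cong n (λ k → cong (λ b → unary C k * bit b) (y≗z k))))
              (sumFin-cong n (λ a → sumFin-cong n (λ b → pairTerm-cong a b (y≗z a) (y≗z b))))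

bitGain : Bool → ℤ
bitGain b = bit (not b) - bit b

module _ {n} (C : SimpleInstance n) {i j : Fin n} (i<j : i <ᶠ j) where

  private
    i≢j : i ≢ j
    i≢j = <⇒≢ i<j

    j≢i : j ≢ i
    j≢i = i≢j ∘ sym

  mixedDiff-pairTerm : ∀ x → mixedDiff (λ y → pairTerm C y i j) x i j ≡
                             binary C i j * (bitGain (x i) * bitGain (x j))
  mixedDiff-pairTerm x = begin
    mixedDiff (λ y → pairTerm C y i j) x i j
      ≡⟨ cong₂ _+_ (cong₂ _-_ (cong₂ _-_
           (atPair (trans (flip-self (flip x j) i) (cong not (flip-other x i≢j)))
                   (trans (flip-other (flip x j) j≢i) (flip-self x j)))
           (atPair (flip-other x i≢j) (flip-self x j)))
           (atPair (flip-self x i) (flip-other x j≢i)))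
           (atPair refl refl) ⟩
    c * (bit (not a) * bit (not b)) - c * (bit a * bit (not b))
      - c * (bit (not a) * bit b) + c * (bit a * bit b)
      ≡⟨ factor c (bit (not a)) (bit a) (bit (not b)) (bit b) ⟩
    c * (bitGain a * bitGain b) ∎
    where
    c : ℤ
    c = binary C i j
    a b : Bool
    a = x i
    b = x j
    atPair : ∀ {y : Assignment n} {u v} → y i ≡ u → y j ≡ v →
             pairTerm C y i j ≡ c * (bit u * bit v)
    atPair {y} yi≡u yj≡v =
      trans (pairTerm-< C y i<j) (cong₂ (λ u v → c * (bit u * bit v)) yi≡u yj≡v)
    factor : ∀ c a′ a b′ b →
      c * (a′ * b′) - c * (a * b′) - c * (a′ * b) + c * (a * b) ≡ c * ((a′ - a) * (b′ - b))
    factor = solve-∀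

  mixedDiff-pairTerm-off : ∀ a b → ¬ (a ≡ i × b ≡ j) → ∀ x →
                           mixedDiff (λ y → pairTerm C y a b) x i j ≡ 0ℤ
  mixedDiff-pairTerm-off a b ≢ij x = go (a ≟ i) (b ≟ i) (a ≟ j) (b ≟ j)
    where
    h : Assignment n → ℤ
    h y = pairTerm C y a b
    go : Dec (a ≡ i) → Dec (b ≡ i) → Dec (a ≡ j) → Dec (b ≡ j) → mixedDiff h x i j ≡ 0ℤ
    go (no a≢i)   (no b≢i)   _          _          =
      mixedDiff-independentˡ h (pairTerm-independent C a≢i b≢i) x j
    go _          _          (no a≢j)   (no b≢j)   =
      mixedDiff-independentʳ h (pairTerm-independent C a≢j b≢j) i≢j x
    go (yes refl) _          (yes a≡j)  _          = ⊥-elim (i≢j a≡j)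
    go (yes refl) _          (no _)     (yes refl) = ⊥-elim (≢ij (refl , refl))
    go (no _)     (yes refl) (no _)     (yes b≡j)  = ⊥-elim (i≢j b≡j)
    go (no _)     (yes refl) (yes refl) _          =
      mixedDiff-independentˡ h (λ {y} {z} _ → trans (pairTerm-≮ C y j≮i) (sym (pairTerm-≮ C z j≮i))) x j
      where
      j≮i : ¬ j <ᶠ i
      j≮i j<i = <-asym j<i i<j

  mixedDiff-eval : ∀ x → mixedDiff (eval C) x i j ≡ binary C i j * (bitGain (x i) * bitGain (x j))
  mixedDiff-eval x = begin
    mixedDiff (eval C) x i j
      ≡⟨ mixedDiff-+ (λ y → const C + unaryPart y) pairPart x i j ⟩
    mixedDiff (λ y → const C + unaryPart y) x i j + mixedDiff pairPart x i j
      ≡⟨ cong₂ _+_ (trans (mixedDiff-+ (λ _ → const C) unaryPart x i j)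
                          (cong₂ _+_ (mixedDiff-independentˡ {i = i} (λ _ → const C) (λ {_} {_} _ → refl) x j)
                                     unaryPart-vanishes))
                   pairPart-single ⟩
    (0ℤ + 0ℤ) + binary C i j * (bitGain (x i) * bitGain (x j))
      ≡⟨ ℤ.+-identityˡ _ ⟩
    binary C i j * (bitGain (x i) * bitGain (x j)) ∎
    where
    unaryPart pairPart : Assignment n → ℤ
    unaryPart y = sumFin n (λ k → unary C k * bit (y k))
    pairPart  y = sumFin n (λ a → sumFin n (λ b → pairTerm C y a b))

    unaryPart-vanishes : mixedDiff unaryPart x i j ≡ 0ℤ
    unaryPart-vanishes = trans (mixedDiff-sumFin n (λ k y → unary C k * bit (y k)) x i j) (sumFin-zero n vanishes)
      where
      vanishes : ∀ k → mixedDiff (λ y → unary C k * bit (y k)) x i j ≡ 0ℤ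
      vanishes k = go (k ≟ i)
        where
        go : Dec (k ≡ i) → mixedDiff (λ y → unary C k * bit (y k)) x i j ≡ 0ℤ
        go (yes refl) = mixedDiff-independentʳ _ (unaryTerm-independent C i≢j) i≢j x
        go (no k≢i)   = mixedDiff-independentˡ _ (unaryTerm-independent C k≢i) x j

    pairPart-single : mixedDiff pairPart x i j ≡ binary C i j * (bitGain (x i) * bitGain (x j))
    pairPart-single = begin
      mixedDiff pairPart x i j
        ≡⟨ mixedDiff-sumFin n (λ a y → sumFin n (λ b → pairTerm C y a b)) x i j ⟩
      sumFin n (λ a → mixedDiff (λ y → sumFin n (λ b → pairTerm C y a b)) x i j)
        ≡⟨ sumFin-single n i (λ a a≢i → trans (mixedDiff-sumFin n (λ b y → pairTerm C y a b) x i j)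
             (sumFin-zero n (λ b → mixedDiff-pairTerm-off a b (a≢i ∘ proj₁) x))) ⟩
      mixedDiff (λ y → sumFin n (λ b → pairTerm C y i b)) x i j
        ≡⟨ mixedDiff-sumFin n (λ b y → pairTerm C y i b) x i j ⟩
      sumFin n (λ b → mixedDiff (λ y → pairTerm C y i b) x i j)
        ≡⟨ sumFin-single n j (λ b b≢j → mixedDiff-pairTerm-off i b (b≢j ∘ proj₂) x) ⟩
      mixedDiff (λ y → pairTerm C y i j) x i j
        ≡⟨ mixedDiff-pairTerm x ⟩
      binary C i j * (bitGain (x i) * bitGain (x j)) ∎

allFalse : Assignment n
allFalse _ = false

module _ (C : SimpleInstance n) where

  pairTerm-falseˡ : ∀ {y : Assignment n} a b → y a ≡ false → pairTerm C y a b ≡ 0ℤ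
  pairTerm-falseˡ {y} a b ya≡false with a <? b
  ... | yes _ rewrite ya≡false = ℤ.*-zeroʳ (binary C a b)
  ... | no _  = refl

  pairTerm-falseʳ : ∀ {y : Assignment n} a b → y b ≡ false → pairTerm C y a b ≡ 0ℤ
  pairTerm-falseʳ {y} a b yb≡false with a <? b
  ... | yes _ rewrite yb≡false =
    trans (cong (binary C a b *_) (ℤ.*-zeroʳ (bit (y a)))) (ℤ.*-zeroʳ (binary C a b))
  ... | no _  = refl

  eval-allFalse : eval C allFalse ≡ const C
  eval-allFalse = begin
    const C + sumFin n (λ k → unary C k * 0ℤ) + sumFin n (λ a → sumFin n (λ b → pairTerm C allFalse a b))
      ≡⟨ cong₂ (λ u p → const C + u + p) (sumFin-zero n (λ k → ℤ.*-zeroʳ (unary C k)))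
                 (sumFin-zero n (λ a → sumFin-zero n (λ b → pairTerm-falseˡ a b refl))) ⟩
    const C + 0ℤ + 0ℤ
      ≡⟨ trans (ℤ.+-identityʳ _) (ℤ.+-identityʳ _) ⟩
    const C ∎

  eval-flip-allFalse : ∀ i → eval C (flip allFalse i) ≡ const C + unary C i
  eval-flip-allFalse i = begin
    const C + unaryPart + pairPart
      ≡⟨ cong₂ (λ u p → const C + u + p) unaryPart-single pairPart-vanishes ⟩
    const C + unary C i + 0ℤ
      ≡⟨ ℤ.+-identityʳ _ ⟩
    const C + unary C i ∎
    where
    e : Assignment n
    e = flip allFalse i
    unaryPart pairPart : ℤ
    unaryPart = sumFin n (λ k → unary C k * bit (e k))
    pairPart  = sumFin n (λ a → sumFin n (λ b → pairTerm C e a b))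

    unaryPart-single : unaryPart ≡ unary C i
    unaryPart-single = begin
      unaryPart
        ≡⟨ sumFin-single n i (λ k k≢i →
             trans (cong (λ v → unary C k * bit v) (flip-other allFalse k≢i)) (ℤ.*-zeroʳ (unary C k))) ⟩
      unary C i * bit (e i)
        ≡⟨ cong (λ v → unary C i * bit v) (flip-self allFalse i) ⟩
      unary C i * 1ℤ
        ≡⟨ ℤ.*-identityʳ (unary C i) ⟩
      unary C i ∎

    pairPart-vanishes : pairPart ≡ 0ℤ
    pairPart-vanishes = sumFin-zero n (λ a → sumFin-zero n (λ b → vanishes a b (a ≟ i) (b ≟ i)))
      where
      vanishes : ∀ a b → Dec (a ≡ i) → Dec (b ≡ i) → pairTerm C e a b ≡ 0ℤ
      vanishes a b (no a≢i) _        = pairTerm-falseˡ a b (flip-other allFalse a≢i)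
      vanishes a b (yes _)  (no b≢i) = pairTerm-falseʳ a b (flip-other allFalse b≢i)
      vanishes a b (yes refl) (yes refl) = pairTerm-≮ C e {a} {a} (λ a<a → <⇒≢ a<a refl)

  edge-flip⇔ : ∀ x i → Edge C x (flip x i) ⇔ eval C x < eval C (flip x i)
  edge-flip⇔ x i = mk⇔ proj₂ (λ lt → (i , refl) , lt)

  unary-pos⇔ : ∀ i → 0ℤ < unary C i ⇔ eval C allFalse < eval C (flip allFalse i)
  unary-pos⇔ i = subst₂ (λ p q → 0ℤ < unary C i ⇔ p < q)
    (trans (ℤ.+-identityʳ (const C)) (sym eval-allFalse)) (sym (eval-flip-allFalse i))
    (+-monoʳ-<-⇔ (const C))

  unary-neg⇔ : ∀ i → unary C i < 0ℤ ⇔ eval C (flip allFalse i) < eval C (flip (flip allFalse i) i)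
  unary-neg⇔ i = subst₂ (λ p q → unary C i < 0ℤ ⇔ p < q)
    (sym (eval-flip-allFalse i))
    (trans (ℤ.+-identityʳ (const C)) (sym (trans (eval-cong C (flip-involutive allFalse i)) eval-allFalse)))
    (+-monoʳ-<-⇔ (const C))

SignDependsAt : SimpleInstance n → Fin n → Fin n → Assignment n → Set
SignDependsAt C i j x = Edge C x (flip x i) × ¬ Edge C (flip x j) (flip (flip x j) i)

signDependsAt⇒mixedDiff<0 : (C : SimpleInstance n) → SignDependsAt C i j x → mixedDiff (eval C) x i j < 0ℤ
signDependsAt⇒mixedDiff<0 {i = i} C (up , ¬up) = i-j-k+l<0 (ℤ.≮⇒≥ (λ lt → ¬up ((i , refl) , lt))) (proj₂ up)

module SignEquivalence (C C′ : SimpleInstance n) (C≈C′ : SignEquivalent C C′) where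

  increase⇔ : ∀ x i → eval C x < eval C (flip x i) ⇔ eval C′ x < eval C′ (flip x i)
  increase⇔ x i = ⇔.trans (⇔.sym (edge-flip⇔ C x i))
    (⇔.trans (mk⇔ (proj₁ (C≈C′ x (flip x i))) (proj₂ (C≈C′ x (flip x i)))) (edge-flip⇔ C′ x i))

  signDependsAt-transfer : SignDependsAt C i j x → SignDependsAt C′ i j x
  signDependsAt-transfer (up , ¬up) = proj₁ (C≈C′ _ _) up , ¬up ∘ proj₂ (C≈C′ _ _)

  unary-sgn-≡ : ∀ i → sgn (unary C i) ≡ sgn (unary C′ i)
  unary-sgn-≡ i = sgn-cong
    (⇔.trans (unary-pos⇔ C i) (⇔.trans (increase⇔ allFalse i) (⇔.sym (unary-pos⇔ C′ i))))
    (⇔.trans (unary-neg⇔ C i) (⇔.trans (increase⇔ (flip allFalse i) i) (⇔.sym (unary-neg⇔ C′ i))))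

  sgn-from-mixedDiffs : i <ᶠ j → mixedDiff (eval C) x i j < 0ℤ × mixedDiff (eval C′) x i j < 0ℤ →
                        sgn (binary C i j) ≡ sgn (binary C′ i j)
  sgn-from-mixedDiffs {x = x} i<j (d<0 , d′<0) = sgn-cong-*-neg _
    (subst (_< 0ℤ) (mixedDiff-eval C i<j x) d<0) (subst (_< 0ℤ) (mixedDiff-eval C′ i<j x) d′<0)

  signDependsAt⇒mixedDiffs<0 : SignDependsAt C i j x →
                               mixedDiff (eval C) x i j < 0ℤ × mixedDiff (eval C′) x i j < 0ℤ
  signDependsAt⇒mixedDiffs<0 dep =
    signDependsAt⇒mixedDiff<0 C dep , signDependsAt⇒mixedDiff<0 C′ (signDependsAt-transfer dep)

  binary-sgn-≡ : i <ᶠ j → SignInteract C i j → sgn (binary C i j) ≡ sgn (binary C′ i j)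
  binary-sgn-≡ i<j (inj₁ (x , dep)) = sgn-from-mixedDiffs i<j (signDependsAt⇒mixedDiffs<0 dep)
  binary-sgn-≡ {i = i} {j} i<j (inj₂ (x , dep)) =
    sgn-from-mixedDiffs i<j (map (swap C) (swap C′) (signDependsAt⇒mixedDiffs<0 dep))
    where
    swap : ∀ D → mixedDiff (eval D) x j i < 0ℤ → mixedDiff (eval D) x i j < 0ℤ
    swap D = subst (_< 0ℤ) (mixedDiff-sym (eval D) (eval-cong D) (<⇒≢ i<j) x)

proposition4 : ∀ {n : ℕ} (C C' : SimpleInstance n) →
    Trim C → SignEquivalent C C' →
    (∀ i → sgn (unary C i) ≡ sgn (unary C' i)) ×
    (∀ i j → InE C i j → sgn (binary C i j) ≡ sgn (binary C' i j))
proposition4 C C' trim C≈C' =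
  unary-sgn-≡ , λ i j ij∈E → binary-sgn-≡ (proj₁ ij∈E) (trim i j ij∈E)
  where open SignEquivalence C C' C≈C'
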